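{- Let $\alpha$ and $\gamma$ be compositions with $\bm\lambda(\alpha)=\bm\lambda(\gamma)$ and $\alpha\ne\gamma$. Then $K_{\alpha,\gamma}=0$, i.e. there is no composition tableau of shape $\alpha$ and content $\gamma$.
   Context: For a composition $\alpha$, $\bm\lambda(\alpha)$ is the partition obtained by arranging its parts in weakly decreasing order. For a composition $\alpha=(\alpha_1,\dots,\alpha_\ell)$, the diagram has $\alpha_i$ cells in row $i$ (rows numbered from top), cell $(i,j)$ in row $i$ column $j$. A composition tableau of shape $\alpha$ is a filling $T$ by positive integers with (CT1) rows weakly decreasing from left to right; (CT2) first column strictly increasing from top to bottom; (CT3) triple rule: for cells $(i,k),(j,k)$ with $i<j$, if $\alpha_i\ge\alpha_j$ then $T(j,k)<T(i,k)$ or $T(i,k-1)<T(j,k)$ (with $T(i,0)$ read as $0$), and if $\alpha_i<\alpha_j$ then $T(j,k)<T(i,k)$ or $T(i,k)<T(j,k+1)$. Its content is $\gamma=(\gamma_1,\dots,\gamma_m)$ if, for each $i$, exactly $\gamma_i$ entries equal $i$ (and no other entries occur). $K_{\alpha,\gamma}$ denotes the number of composition tableaux of shape $\alpha$ and content $\gamma$; it is the coefficient of $M_\gamma$ in the expansion of the quasisymmetric Schur polynomial $\mathcal{S}_\alpha$ in quasi-monomials $M_\gamma=\sum_{i_1<\dots<i_m}x_{i_1}^{\gamma_1}\cdots x_{i_m}^{\gamma_m}$. -}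

module Defs where

open import Data.Nat using (ℕ; zero; suc; _≤_; _<_; _≟_; _∸_)
open import Data.Nat.ListAction using (sum)
open import Relation.Binary.PropositionalEquality using (_≡_)
open import Data.Nat.Properties using (≤-decTotalOrder)
open import Data.Fin using (Fin; toℕ) renaming (_<_ to _<ᶠ_)
open import Data.List using (List; length; lookup; reverse; map; filter; upTo; allFin)
open import Data.List.Relation.Unary.All using (All)
open import Data.Product using (_×_)
open import Data.Sum using (_⊎_)
import Data.List.Sort.MergeSort as MS

IsComposition : List ℕ → Set
IsComposition α = All (λ a → 0 < a) α

partitionOf : List ℕ → List ℕ
partitionOf α = reverse (MS.sort ≤-decTotalOrder α)

-- A filling of the diagram of α: rows indexed by Fin (length α) (row 1 = index 0),
-- columns by ℕ (1-based); only cells (i,k) with 1 ≤ k ≤ α_i matter.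
Filling : List ℕ → Set
Filling α = Fin (length α) → ℕ → ℕ

rowLen : (α : List ℕ) → Fin (length α) → ℕ
rowLen α i = lookup α i

entry : {α : List ℕ} → Filling α → Fin (length α) → ℕ → ℕ
entry T i zero = 0
entry T i (suc k) = T i (suc k)

CT1 : (α : List ℕ) → Filling α → Set
CT1 α T = ∀ i k → 1 ≤ k → suc k ≤ rowLen α i → T i (suc k) ≤ T i k

CT2 : (α : List ℕ) → Filling α → Set
CT2 α T = ∀ (i j : Fin (length α)) → i <ᶠ j → T i 1 < T j 1

CT3 : (α : List ℕ) → Filling α → Set
CT3 α T = ∀ (i j : Fin (length α)) (k : ℕ) → i <ᶠ j → 1 ≤ k →
  k ≤ rowLen α i → k ≤ rowLen α j →
  (rowLen α j ≤ rowLen α i → (T j k < T i k) ⊎ (entry {α} T i (k ∸ 1) < T j k)) ×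
  (rowLen α i < rowLen α j → (T j k < T i k) ⊎ (T i k < T j (suc k)))

IsCompositionTableau : (α : List ℕ) → Filling α → Set
IsCompositionTableau α T = CT1 α T × CT2 α T × CT3 α T

countEntries : (α : List ℕ) → Filling α → ℕ → ℕ
countEntries α T v =
  sum (map (λ i → length (filter (λ k → T i k ≟ v) (map suc (upTo (rowLen α i)))))
           (allFin (length α)))

HasContent : (α γ : List ℕ) → Filling α → Set
HasContent α γ T =
  (∀ i k → 1 ≤ k → k ≤ rowLen α i → 1 ≤ T i k × T i k ≤ length γ) ×
  (∀ (v : Fin (length γ)) → countEntries α T (suc (toℕ v)) ≡ lookup γ v)

-- Let n be the number of rows.  By (CT2) the first column is strictly increasing
-- with entries in {1,…,n}, so row i starts with i.  Column by column, row i is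
-- then filled with i only: if T(i,c+1) = x < i, the triple rule (CT3) with
-- rows x and i rules this out when row x reaches column c, and otherwise row x
-- (entirely x) and the cell (i,c+1) give more than α_x entries x, so
-- ∑ min(α_r,c) < ∑ min(γ_r,c), impossible as γ is a rearrangement of α.
-- Hence γ_i ≥ α_i for all i, and |α| = |γ| forces α = γ.
module Submission where

open import Defs
open import Data.Fin using (Fin; toℕ; fromℕ; fromℕ<) renaming (zero to fz; suc to fs; _<_ to _<ᶠ_)
open import Data.Fin.Properties using (toℕ<n; toℕ≤pred[n]; toℕ-fromℕ<)
open import Data.List using (List; []; _∷_; _++_; length; lookup; map; filter; upTo; tabulate)
open import Data.List.Properties using (upTo-∷ʳ; map-++; filter-++; length-++; filter-accept; map-tabulate; tabulate-lookup; tabulate-cong)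
open import Data.List.Relation.Binary.Permutation.Propositional using (_↭_; ↭-sym; ↭-trans)
open import Data.List.Relation.Binary.Permutation.Propositional.Properties using (↭-length; ↭-reverse; map⁺)
open import Data.List.Relation.Binary.Pointwise using (lookup⁻; Pointwise-≡⇒≡)
import Data.List.Relation.Unary.All as All
open import Data.List.Membership.Propositional.Properties using (∈-lookup)
open import Data.Nat using (ℕ; zero; suc; _+_; _≤_; _<_; _≤′_; ≤′-reflexive; ≤′-step; _≟_; _∸_; _⊓_; z≤n; s≤s; s≤s⁻¹; _≤?_)
open import Data.Nat.ListAction using (sum)
open import Data.Nat.ListAction.Properties using (sum-↭)
open import Data.Nat.Properties
open import Data.List.Sort.MergeSort.Properties ≤-decTotalOrder using (sort-↭)
open import Data.Product using (Σ; _×_; _,_; proj₁; proj₂)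
open import Data.Sum using (inj₁; inj₂)
open import Function using (_∘_; id)
open import Relation.Binary.PropositionalEquality
open import Relation.Nullary using (¬_; yes; no; contradiction)

StrictlyIncreasing : ∀ {n} → (Fin n → ℕ) → Set
StrictlyIncreasing f = ∀ {i j} → i <ᶠ j → f i < f j

strictlyIncreasing-lower : ∀ {n} (f : Fin (suc n) → ℕ) → StrictlyIncreasing f →
                           ∀ i → f fz + toℕ i ≤ f i
strictlyIncreasing-lower f inc fz = ≤-reflexive (+-identityʳ (f fz))
strictlyIncreasing-lower {suc _} f inc (fs i) = begin
  f fz + suc (toℕ i)  ≡⟨ +-suc (f fz) (toℕ i) ⟩
  suc (f fz) + toℕ i  ≤⟨ +-monoˡ-≤ (toℕ i) (inc {fz} {fs fz} (s≤s z≤n)) ⟩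
  f (fs fz) + toℕ i   ≤⟨ strictlyIncreasing-lower (f ∘ fs) (inc ∘ s≤s) i ⟩
  f (fs i)            ∎
  where open ≤-Reasoning

strictlyIncreasing-upper : ∀ {n} (f : Fin (suc n) → ℕ) → StrictlyIncreasing f →
                           ∀ i → f i + (n ∸ toℕ i) ≤ f (fromℕ n)
strictlyIncreasing-upper {zero} f inc fz = ≤-reflexive (+-identityʳ (f fz))
strictlyIncreasing-upper {suc n} f inc fz = begin
  f fz + suc n       ≡⟨ +-suc (f fz) n ⟩
  suc (f fz) + n     ≤⟨ +-monoˡ-≤ n (inc {fz} {fs fz} (s≤s z≤n)) ⟩
  f (fs fz) + n      ≤⟨ strictlyIncreasing-upper (f ∘ fs) (inc ∘ s≤s) fz ⟩
  f (fromℕ (suc n))  ∎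
  where open ≤-Reasoning
strictlyIncreasing-upper {suc n} f inc (fs i) = strictlyIncreasing-upper (f ∘ fs) (inc ∘ s≤s) i

strictlyIncreasing-1…n⇒suc-toℕ : ∀ {n} (f : Fin n → ℕ) → StrictlyIncreasing f →
                         (∀ i → 1 ≤ f i) → (∀ i → f i ≤ n) → ∀ i → f i ≡ suc (toℕ i)
strictlyIncreasing-1…n⇒suc-toℕ {suc n} f inc pos bounded i = ≤-antisym upper lower
  where
  lower : suc (toℕ i) ≤ f i
  lower = ≤-trans (+-monoˡ-≤ (toℕ i) (pos fz)) (strictlyIncreasing-lower f inc i)
  upper : f i ≤ suc (toℕ i)
  upper = +-cancelʳ-≤ (n ∸ toℕ i) (f i) (suc (toℕ i)) (begin
    f i + (n ∸ toℕ i)          ≤⟨ strictlyIncreasing-upper f inc i ⟩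
    f (fromℕ n)                ≤⟨ bounded (fromℕ n) ⟩
    suc n                      ≡⟨ cong suc (m+[n∸m]≡n (toℕ≤pred[n] i)) ⟨
    suc (toℕ i) + (n ∸ toℕ i)  ∎)
    where open ≤-Reasoning

∑ : ∀ {n} → (Fin n → ℕ) → ℕ
∑ f = sum (tabulate f)

∑-cong : ∀ {n} {f g : Fin n → ℕ} → (∀ i → f i ≡ g i) → ∑ f ≡ ∑ g
∑-cong f≗g = cong sum (tabulate-cong f≗g)

sum-map-lookup : ∀ (f : ℕ → ℕ) xs → sum (map f xs) ≡ ∑ (f ∘ lookup xs)
sum-map-lookup f xs = begin
  sum (map f xs)                     ≡⟨ cong (sum ∘ map f) (tabulate-lookup xs) ⟨
  sum (map f (tabulate (lookup xs))) ≡⟨ cong sum (map-tabulate (lookup xs) f) ⟩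
  ∑ (f ∘ lookup xs)                  ∎
  where open ≡-Reasoning

term≤∑ : ∀ {n} (f : Fin n → ℕ) i → f i ≤ ∑ f
term≤∑ f fz = m≤m+n (f fz) _
term≤∑ f (fs i) = ≤-trans (term≤∑ (f ∘ fs) i) (m≤n+m _ (f fz))

two-terms≤∑ : ∀ {n} (f : Fin n → ℕ) {i j} → i ≢ j → f i + f j ≤ ∑ f
two-terms≤∑ f {fz} {fz} i≢j = contradiction refl i≢j
two-terms≤∑ f {fz} {fs j} _ = +-monoʳ-≤ (f fz) (term≤∑ (f ∘ fs) j)
two-terms≤∑ f {fs i} {fz} _ = subst (_≤ ∑ f) (+-comm (f fz) (f (fs i))) (+-monoʳ-≤ (f fz) (term≤∑ (f ∘ fs) i))
two-terms≤∑ f {fs i} {fs j} i≢j = ≤-trans (two-terms≤∑ (f ∘ fs) (i≢j ∘ cong fs)) (m≤n+m _ (f fz))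

∑-mono-≤ : ∀ {n} {f g : Fin n → ℕ} → (∀ i → f i ≤ g i) → ∑ f ≤ ∑ g
∑-mono-≤ {zero} f≤g = z≤n
∑-mono-≤ {suc n} f≤g = +-mono-≤ (f≤g fz) (∑-mono-≤ (f≤g ∘ fs))

∑-mono-< : ∀ {n} {f g : Fin n → ℕ} → (∀ i → f i ≤ g i) → ∀ i → f i < g i → ∑ f < ∑ g
∑-mono-< f≤g fz fi<gi = +-mono-<-≤ fi<gi (∑-mono-≤ (f≤g ∘ fs))
∑-mono-< f≤g (fs i) fi<gi = +-mono-≤-< (f≤g fz) (∑-mono-< (f≤g ∘ fs) i fi<gi)

∑-mono-≤∧∑≡⇒≡ : ∀ {n} {f g : Fin n → ℕ} → (∀ i → f i ≤ g i) → ∑ f ≡ ∑ g → ∀ i → f i ≡ g i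
∑-mono-≤∧∑≡⇒≡ {f = f} {g} f≤g ∑f≡∑g i with f i ≟ g i
... | yes fi≡gi = fi≡gi
... | no fi≢gi = contradiction ∑f≡∑g (<⇒≢ (∑-mono-< f≤g i (≤∧≢⇒< (f≤g i) fi≢gi)))

count : (ℕ → ℕ) → ℕ → ℕ → ℕ
count f v a = length (filter (λ k → f k ≟ v) (map suc (upTo a)))

count-suc : ∀ f v a → count f v (suc a) ≡ count f v a + length (filter (λ k → f k ≟ v) (suc a ∷ []))
count-suc f v a = begin
  length (filter P? (map suc (upTo (suc a))))          ≡⟨ cong (length ∘ filter P? ∘ map suc) (upTo-∷ʳ a) ⟨
  length (filter P? (map suc (upTo a ++ a ∷ [])))      ≡⟨ cong (length ∘ filter P?) (map-++ suc (upTo a) (a ∷ [])) ⟩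
  length (filter P? (map suc (upTo a) ++ suc a ∷ []))  ≡⟨ cong length (filter-++ P? (map suc (upTo a)) (suc a ∷ [])) ⟩
  length (filter P? (map suc (upTo a)) ++ filter P? (suc a ∷ []))
                                                       ≡⟨ length-++ (filter P? (map suc (upTo a))) ⟩
  count f v a + length (filter P? (suc a ∷ []))        ∎
  where
  open ≡-Reasoning
  P? = λ k → f k ≟ v

count-hit : ∀ f v a → f (suc a) ≡ v → count f v (suc a) ≡ suc (count f v a)
count-hit f v a fa≡v = begin
  count f v (suc a)                              ≡⟨ count-suc f v a ⟩
  count f v a + length (filter P? (suc a ∷ []))  ≡⟨ cong ((count f v a +_) ∘ length) (filter-accept P? {xs = []} fa≡v) ⟩
  count f v a + 1                                ≡⟨ +-comm (count f v a) 1 ⟩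
  suc (count f v a)                              ∎
  where
  open ≡-Reasoning
  P? = λ k → f k ≟ v

count-mono : ∀ f v {a b} → a ≤ b → count f v a ≤ count f v b
count-mono f v = mono′ ∘ ≤⇒≤′
  where
  mono′ : ∀ {a b} → a ≤′ b → count f v a ≤ count f v b
  mono′ (≤′-reflexive refl) = ≤-refl
  mono′ (≤′-step {b} a≤′b) = ≤-trans (mono′ a≤′b) (subst (count f v b ≤_) (sym (count-suc f v b)) (m≤m+n _ _))

constant⇒≤count : ∀ f v {q a} → q ≤ a → (∀ k → 1 ≤ k → k ≤ q → f k ≡ v) → q ≤ count f v a
constant⇒≤count f v {q} q≤a f≡v = ≤-trans (prefix q f≡v) (count-mono f v q≤a)
  where
  prefix : ∀ q → (∀ k → 1 ≤ k → k ≤ q → f k ≡ v) → q ≤ count f v q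
  prefix zero _ = z≤n
  prefix (suc q) f≡v = subst (suc q ≤_) (sym (count-hit f v q (f≡v (suc q) (s≤s z≤n) ≤-refl)))
                             (s≤s (prefix q (λ k 1≤k k≤q → f≡v k 1≤k (m≤n⇒m≤1+n k≤q))))

hit⇒1≤count : ∀ f v {k a} → f (suc k) ≡ v → suc k ≤ a → 1 ≤ count f v a
hit⇒1≤count f v {k} fk≡v sk≤a = ≤-trans (subst (1 ≤_) (sym (count-hit f v k fk≡v)) (s≤s z≤n)) (count-mono f v sk≤a)

earlierIndex : ∀ {n} (i : Fin n) {t} → 1 ≤ t → t ≤ toℕ i → Σ (Fin n) (λ x → x <ᶠ i × t ≡ suc (toℕ x))
earlierIndex i {suc y} _ y<i =
  fromℕ< y<n , subst (_< toℕ i) (sym (toℕ-fromℕ< y<n)) y<i , cong suc (sym (toℕ-fromℕ< y<n))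
  where
  y<n : y < _
  y<n = <-trans y<i (toℕ<n i)

partitionOf-↭ : ∀ xs → partitionOf xs ↭ xs
partitionOf-↭ xs = ↭-trans (↭-reverse _) (sort-↭ xs)

module _ {α γ : List ℕ} (α↭γ : α ↭ γ) (composition : IsComposition α) {T : Filling α}
         (tableau : IsCompositionTableau α T) (hasContent : HasContent α γ T) where

  private
    n : ℕ
    n = length α

    a : Fin n → ℕ
    a = rowLen α

    ct1 : CT1 α T
    ct1 = proj₁ tableau

    ct2 : CT2 α T
    ct2 = proj₁ (proj₂ tableau)

    ct3 : CT3 α T
    ct3 = proj₂ (proj₂ tableau)

    bounded : ∀ i k → 1 ≤ k → k ≤ a i → 1 ≤ T i k × T i k ≤ length γ
    bounded = proj₁ hasContent

    #entries : ℕ → ℕ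
    #entries = countEntries α T

    -- g r = γ_r, the number of entries r + 1 (rows are indexed from 0)
    g : Fin n → ℕ
    g r = #entries (suc (toℕ r))

  #entries-by-rows : ∀ v → #entries v ≡ ∑ (λ r → count (T r) v (a r))
  #entries-by-rows v = cong sum (map-tabulate id (λ r → count (T r) v (a r)))

  lookup-γ : ∀ j → lookup γ j ≡ #entries (suc (toℕ j))
  lookup-γ j = sym (proj₂ hasContent j)

  ∑-shape≡∑-content : ∀ (f : ℕ → ℕ) → ∑ (f ∘ a) ≡ ∑ (f ∘ g)
  ∑-shape≡∑-content f = begin
    ∑ (f ∘ lookup α)       ≡⟨ sum-map-lookup f α ⟨
    sum (map f α)          ≡⟨ sum-↭ (map⁺ f α↭γ) ⟩
    sum (map f γ)          ≡⟨ sum-map-lookup f γ ⟩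
    ∑ (f ∘ lookup γ)       ≡⟨ ∑-cong (cong f ∘ lookup-γ) ⟩
    ∑ {length γ} (f ∘ g′)  ≡⟨ cong (λ m → ∑ {m} (f ∘ g′)) (↭-length α↭γ) ⟨
    ∑ (f ∘ g)              ∎
    where
    open ≡-Reasoning
    g′ : ∀ {m} → Fin m → ℕ
    g′ j = #entries (suc (toℕ j))

  firstColumn : ∀ i → T i 1 ≡ suc (toℕ i)
  firstColumn = strictlyIncreasing-1…n⇒suc-toℕ (λ i → T i 1) (λ {i} {j} → ct2 i j) (proj₁ ∘ bounded₁)
                  (λ i → subst (T i 1 ≤_) (sym (↭-length α↭γ)) (proj₂ (bounded₁ i)))
    where
    bounded₁ : ∀ i → 1 ≤ T i 1 × T i 1 ≤ length γ
    bounded₁ i = bounded i 1 ≤-refl (All.lookup composition (∈-lookup i))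

  RowsFilledUpTo : ℕ → Set
  RowsFilledUpTo c = ∀ i k → 1 ≤ k → k ≤ c → k ≤ a i → T i k ≡ suc (toℕ i)

  rowsFilled⇒⊓≤content : ∀ {c} → RowsFilledUpTo c → ∀ r → a r ⊓ c ≤ g r
  rowsFilled⇒⊓≤content {c} filled r = begin
    a r ⊓ c                          ≤⟨ constant⇒≤count (T r) _ (m⊓n≤m (a r) c) filledRow ⟩
    count (T r) (suc (toℕ r)) (a r)  ≤⟨ term≤∑ count-r r ⟩
    ∑ count-r                        ≡⟨ #entries-by-rows (suc (toℕ r)) ⟨
    g r                              ∎
    where
    open ≤-Reasoning
    count-r : Fin n → ℕ
    count-r r′ = count (T r′) (suc (toℕ r)) (a r′)
    filledRow : ∀ k → 1 ≤ k → k ≤ a r ⊓ c → T r k ≡ suc (toℕ r)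
    filledRow k 1≤k k≤ = filled r k 1≤k (≤-trans k≤ (m⊓n≤n (a r) c)) (≤-trans k≤ (m⊓n≤m (a r) c))

  -- c is a successor so that the term entry T x (suc c ∸ 1) of (CT3) reduces to T x c.
  module NextColumn (c₀ : ℕ) (filled : RowsFilledUpTo (suc c₀)) where

    c : ℕ
    c = suc c₀

    filledAt : ∀ i → c ≤ a i → T i c ≡ suc (toℕ i)
    filledAt i c≤ai = filled i c (s≤s z≤n) ≤-refl c≤ai

    notFromLongerRow : ∀ {x i} → x <ᶠ i → suc c ≤ a i → T i (suc c) ≡ suc (toℕ x) → ¬ (c ≤ a x)
    notFromLongerRow {x} {i} x<i sc≤ai Ti≡x c≤ax with a i ≤? a x
    ... | yes ai≤ax with proj₁ (ct3 x i (suc c) x<i (s≤s z≤n) (≤-trans sc≤ai ai≤ax) sc≤ai) ai≤ax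
    ...   | inj₁ Ti<Tx = <-irrefl refl (begin-strict
            T i (suc c)  <⟨ Ti<Tx ⟩
            T x (suc c)  ≤⟨ ct1 x c (s≤s z≤n) (≤-trans sc≤ai ai≤ax) ⟩
            T x c        ≡⟨ filledAt x c≤ax ⟩
            suc (toℕ x)  ≡⟨ Ti≡x ⟨
            T i (suc c)  ∎)
      where open ≤-Reasoning
    ...   | inj₂ Tx<Ti = <-irrefl (trans (filledAt x c≤ax) (sym Ti≡x)) Tx<Ti
    notFromLongerRow {x} {i} x<i sc≤ai Ti≡x c≤ax | no ai≰ax
      with proj₂ (ct3 x i c x<i (s≤s z≤n) c≤ax (≤-trans (n≤1+n c) sc≤ai)) (≰⇒> ai≰ax)
    ...   | inj₁ Tic<Txc = <⇒≱ Tic<Txc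
              (subst₂ _≤_ (sym (filledAt x c≤ax)) (sym (filledAt i (≤-trans (n≤1+n c) sc≤ai))) (<⇒≤ (s≤s x<i)))
    ...   | inj₂ Tx<Ti = <-irrefl (trans (filledAt x c≤ax) (sym Ti≡x)) Tx<Ti

    notFromShorterRow : ∀ {x i} → x <ᶠ i → suc c ≤ a i → T i (suc c) ≡ suc (toℕ x) → ¬ (a x < c)
    notFromShorterRow {x} {i} x<i sc≤ai Ti≡x ax<c =
      <-irrefl (∑-shape≡∑-content (_⊓ c)) (∑-mono-< (λ r → ⊓-glb (rowsFilled⇒⊓≤content filled r) (m⊓n≤n (a r) c)) x ax⊓c<gx⊓c)
      where
      count-x : Fin n → ℕ
      count-x r = count (T r) (suc (toℕ x)) (a r)
      ax<gx : a x < g x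
      ax<gx = begin
        suc (a x)             ≡⟨ +-comm 1 (a x) ⟩
        a x + 1               ≤⟨ +-mono-≤ (constant⇒≤count (T x) _ ≤-refl (λ k 1≤k k≤ax → filled x k 1≤k (≤-trans k≤ax (<⇒≤ ax<c)) k≤ax))
                                          (hit⇒1≤count (T i) _ Ti≡x sc≤ai) ⟩
        count-x x + count-x i ≤⟨ two-terms≤∑ count-x (<⇒≢ x<i ∘ cong toℕ) ⟩
        ∑ count-x             ≡⟨ #entries-by-rows (suc (toℕ x)) ⟨
        g x                   ∎
        where open ≤-Reasoning
      ax⊓c<gx⊓c : a x ⊓ c < g x ⊓ c
      ax⊓c<gx⊓c = subst (_< g x ⊓ c) (sym (m≤n⇒m⊓n≡m (<⇒≤ ax<c))) (⊓-glb ax<gx ax<c)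

    notFromEarlierRow : ∀ {x i} → x <ᶠ i → suc c ≤ a i → T i (suc c) ≢ suc (toℕ x)
    notFromEarlierRow {x} x<i sc≤ai Ti≡x with c ≤? a x
    ... | yes c≤ax = notFromLongerRow x<i sc≤ai Ti≡x c≤ax
    ... | no c≰ax = notFromShorterRow x<i sc≤ai Ti≡x (≰⇒> c≰ax)

    nextColumn : ∀ i → suc c ≤ a i → T i (suc c) ≡ suc (toℕ i)
    nextColumn i sc≤ai with T i (suc c) ≟ suc (toℕ i)
    ... | yes Ti≡i = Ti≡i
    ... | no Ti≢i =
      let x , x<i , Ti≡x = earlierIndex i (proj₁ (bounded i (suc c) (s≤s z≤n) sc≤ai)) (s≤s⁻¹ (≤∧≢⇒< Ti≤i Ti≢i))
      in contradiction Ti≡x (notFromEarlierRow x<i sc≤ai)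
      where
      Ti≤i : T i (suc c) ≤ suc (toℕ i)
      Ti≤i = subst (T i (suc c) ≤_) (filledAt i (≤-trans (n≤1+n c) sc≤ai)) (ct1 i c (s≤s z≤n) sc≤ai)

    filledNext : RowsFilledUpTo (suc c)
    filledNext i k 1≤k k≤sc k≤ai with m≤n⇒m<n∨m≡n k≤sc
    ... | inj₁ k<sc = filled i k 1≤k (s≤s⁻¹ k<sc) k≤ai
    ... | inj₂ refl = nextColumn i k≤ai

  rowsFilled : ∀ c → RowsFilledUpTo c
  rowsFilled zero i zero () _ _
  rowsFilled zero i (suc k) _ () _
  rowsFilled (suc zero) i (suc zero) _ _ _ = firstColumn i
  rowsFilled (suc zero) i (suc (suc k)) _ (s≤s ()) _
  rowsFilled (suc (suc c)) = NextColumn.filledNext c (rowsFilled (suc c))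

  shape≡content : α ≡ γ
  shape≡content = Pointwise-≡⇒≡ (lookup⁻ (↭-length α↭γ) λ {i} {j} i≡j → begin
    lookup α i              ≡⟨ a≡g i ⟩
    #entries (suc (toℕ i))  ≡⟨ cong (#entries ∘ suc) i≡j ⟩
    #entries (suc (toℕ j))  ≡⟨ lookup-γ j ⟨
    lookup γ j              ∎)
    where
    open ≡-Reasoning
    a≤g : ∀ r → a r ≤ g r
    a≤g r = subst (_≤ g r) (⊓-idem (a r)) (rowsFilled⇒⊓≤content (rowsFilled (a r)) r)
    a≡g : ∀ r → a r ≡ g r
    a≡g = ∑-mono-≤∧∑≡⇒≡ a≤g (∑-shape≡∑-content id)

lemma5p2 : (α γ : List ℕ) → IsComposition α → IsComposition γ →
    partitionOf α ≡ partitionOf γ → α ≢ γ →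
    ¬ (Σ (Filling α) (λ T → IsCompositionTableau α T × HasContent α γ T))
lemma5p2 α γ composition _ λα≡λγ α≢γ (T , tableau , hasContent) =
  α≢γ (shape≡content α↭γ composition tableau hasContent)
  where
  α↭γ : α ↭ γ
  α↭γ = ↭-trans (↭-sym (partitionOf-↭ α)) (subst (_↭ γ) (sym λα≡λγ) (partitionOf-↭ γ))
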